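{- Let $n\ge 2$ and let $M_B$ be the $n\times 2^n$ binary matrix whose $i$-th row ($1\le i\le n$) consists of $2^{i-1}$ consecutive blocks, each block being $2^{n-i}$ entries equal to $1$ followed by $2^{n-i}$ entries equal to $0$ (the Boolean form of a generating matrix of the Hadamard code of type $[2^n,n,2^{n-1}]_2$). Then there exist a Boolean algebra $\mathcal{B}$ with $2^n$ elements and an enumeration $b_1,\dots,b_{2^n}$ of its elements such that $\mathcal{B}$ has $n$ ideals $J_1,\dots,J_n$ of cardinality $2^{n-1}$ whose codewords $c_{J_1},\dots,c_{J_n}$ (with respect to this enumeration) are exactly the rows of $M_B$, $c_{J_i}$ being the $i$-th row.
   Context: An ideal of a Boolean algebra $\mathcal{B}$ is a nonempty subset $J\subseteq\mathcal{B}$ such that $x\le j\in J$ implies $x\in J$, and $i,j\in J$ implies $i\vee j\in J$. For a subset $J$ of $\mathcal{B}=\{b_1,\dots,b_{2^n}\}$, its codeword is $c_J=(c_1,\dots,c_{2^n})\in\mathbb{Z}_2^{2^n}$ with $c_k=1$ if $b_k\in J$ and $c_k=0$ otherwise. -}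

module Defs where

open import Level using (0ℓ)
open import Data.Nat using (ℕ; zero; suc; _^_; _∸_; _<_; _<ᵇ_; NonZero)
open import Data.Nat.Properties using (m^n≢0)
open import Data.Nat.DivMod using (_%_)
open import Data.Bool using (Bool; true; false)
open import Data.Fin using (Fin; toℕ)
open import Data.Fin.Subset using (Subset; ∣_∣)
open import Data.Vec using (Vec; tabulate)
open import Data.Product using (Σ; ∃; _×_)
open import Relation.Binary.PropositionalEquality using (_≡_)
open import Algebra.Lattice.Bundles using (BooleanAlgebra)

-- Entry (i,k) of M_B, 0-indexed (paper row i+1, column k+1).
-- Row i+1 consists of 2^i blocks, each of 2^(n-i-1) ones followed by
-- 2^(n-i-1) zeros; so the entry is 1 iff (k mod 2^(n-i)) < 2^(n-i-1).
MB-entry : (n : ℕ) → Fin n → Fin (2 ^ n) → Bool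
MB-entry n i k =
  (toℕ k % (2 ^ (n ∸ toℕ i))) {{m^n≢0 2 (n ∸ toℕ i)}} <ᵇ 2 ^ (n ∸ suc (toℕ i))

MB-row : (n : ℕ) → Fin n → Vec Bool (2 ^ n)
MB-row n i = tabulate (MB-entry n i)

module _ (B : BooleanAlgebra 0ℓ 0ℓ) where
  open BooleanAlgebra B

  _≤B_ : Carrier → Carrier → Set
  x ≤B y = (x ∧ y) ≈ x

  IsSubset : (Carrier → Bool) → Set
  IsSubset J = ∀ x y → x ≈ y → J x ≡ J y

  IsIdeal : (Carrier → Bool) → Set
  IsIdeal J =
    IsSubset J
    × (∃ λ x → J x ≡ true)
    × (∀ x j → x ≤B j → J j ≡ true → J x ≡ true)
    × (∀ i j → J i ≡ true → J j ≡ true → J (i ∨ j) ≡ true)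

  IsEnumeration : (m : ℕ) → (Fin m → Carrier) → Set
  IsEnumeration m b =
    (∀ k l → b k ≈ b l → k ≡ l) × (∀ x → ∃ λ k → b k ≈ x)

  codeword : {m : ℕ} → (Fin m → Carrier) → (Carrier → Bool) → Vec Bool m
  codeword b J = tabulate (λ k → J (b k))

  -- cardinality of J (counted through the enumeration, which is a bijection)
  card : {m : ℕ} → (Fin m → Carrier) → (Carrier → Bool) → ℕ
  card b J = ∣ codeword b J ∣

-- Take for B the power set of an n-element set, i.e. the Boolean algebra
-- of functions Fin n → Bool, enumerated by reading k < 2^n in binary with
-- the most significant digit first.  For each coordinate i the set
-- J_i = {f | f i = false} is an ideal (the principal ideal of ¬ e_i) of
-- size 2^(n-1), and f ∈ J_i holds for the k-th element exactly when the
-- i-th binary digit of k is 0, which is what row i of M_B records.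
module Submission where

open import Defs
open import Level using (0ℓ; _⊔_)
open import Data.Nat using (ℕ; _≤_; _^_; _∸_)
open import Data.Bool using (Bool)
open import Data.Fin using (Fin)
open import Data.Product using (Σ; _×_)
open import Relation.Binary.PropositionalEquality using (_≡_)
open import Algebra.Lattice.Bundles using (BooleanAlgebra)

open import Data.Nat using (zero; suc; _+_; _*_; _<ᵇ_)
open import Data.Nat.Properties
  using (_<?_; m^n≢0; ^-distribˡ-+-*; m∸n+n≡m; m∸n≤m; m≤m+n; ≤⇒≯; +-identityʳ)
open import Data.Nat.DivMod using (_%_; m<n⇒m%n≡m; %-remove-+ˡ)
open import Data.Nat.Divisibility using (_∣_; divides; ∣-trans; m∣m*n)
open import Data.Bool using (true; false; not; _∧_; _∨_)
open import Data.Bool.Properties using (∨-∧-booleanAlgebra)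
open import Data.Fin using (zero; suc; toℕ; _↑ˡ_; _↑ʳ_; combine; remQuot; finToFun; funToFin)
open import Data.Fin.Properties
  using (toℕ<n; toℕ-↑ˡ; toℕ-↑ʳ; toℕ-combine; 2↔Bool;
         remQuot-combine; combine-remQuot; funToFin-finToFin; finToFun-funToFin)
open import Data.Fin.Subset using (∣_∣; ⊤; ⊥)
open import Data.Fin.Subset.Properties using (∣⊤∣≡n; ∣⊥∣≡0)
open import Data.Vec using (tabulate; replicate; allFin)
open import Data.Vec.Properties using (tabulate-cong; tabulate-∘; map-const)
import Data.Vec.Functional as Vector
open import Data.Product using (_,_; proj₁; proj₂)
open import Function using (_∘_; id; Inverse)
open import Relation.Binary.PropositionalEquality
  using (refl; sym; trans; cong; cong₂; subst; _≗_; module ≡-Reasoning)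
open import Relation.Nullary.Decidable using (dec-true; dec-false)

open ≡-Reasoning

pointwise : ∀ {c ℓ i} → BooleanAlgebra c ℓ → (I : Set i) → BooleanAlgebra (c ⊔ i) (ℓ ⊔ i)
pointwise B I = record
  { Carrier = I → B.Carrier
  ; _≈_ = λ f g → ∀ i → f i B.≈ g i
  ; _∨_ = λ f g i → f i B.∨ g i
  ; _∧_ = λ f g i → f i B.∧ g i
  ; ¬_ = λ f i → B.¬ f i
  ; ⊤ = λ _ → B.⊤
  ; ⊥ = λ _ → B.⊥
  ; isBooleanAlgebra = record
    { isDistributiveLattice = record
      { isLattice = record
        { isEquivalence = record
          { refl = λ _ → B.refl ; sym = λ p i → B.sym (p i) ; trans = λ p q i → B.trans (p i) (q i) }
        ; ∨-comm = λ f g i → B.∨-comm (f i) (g i)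
        ; ∨-assoc = λ f g h i → B.∨-assoc (f i) (g i) (h i)
        ; ∨-cong = λ p q i → B.∨-cong (p i) (q i)
        ; ∧-comm = λ f g i → B.∧-comm (f i) (g i)
        ; ∧-assoc = λ f g h i → B.∧-assoc (f i) (g i) (h i)
        ; ∧-cong = λ p q i → B.∧-cong (p i) (q i)
        ; absorptive = (λ f g i → proj₁ B.absorptive (f i) (g i))
                     , (λ f g i → proj₂ B.absorptive (f i) (g i))
        }
      ; ∨-distrib-∧ = (λ f g h i → proj₁ B.∨-distrib-∧ (f i) (g i) (h i))
                    , (λ f g h i → proj₂ B.∨-distrib-∧ (f i) (g i) (h i))
      ; ∧-distrib-∨ = (λ f g h i → proj₁ B.∧-distrib-∨ (f i) (g i) (h i))
                    , (λ f g h i → proj₂ B.∧-distrib-∨ (f i) (g i) (h i))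
      }
    ; ∨-complement = (λ f i → proj₁ B.∨-complement (f i)) , (λ f i → proj₂ B.∨-complement (f i))
    ; ∧-complement = (λ f i → proj₁ B.∧-complement (f i)) , (λ f i → proj₂ B.∧-complement (f i))
    ; ¬-cong = λ p i → B.¬-cong (p i)
    }
  }
  where module B = BooleanAlgebra B

coordinate-ideal : (I : Set) (i : I) →
                   IsIdeal (pointwise ∨-∧-booleanAlgebra I) (λ f → not (f i))
coordinate-ideal I i =
    (λ f g f≈g → cong not (f≈g i))
  , ((λ _ → false) , refl)
  , (λ f g f≤g g∈J → below-false (f≤g i) g∈J)
  , (λ f g f∈J g∈J → join-false f∈J g∈J)
  where
  below-false : ∀ {x y} → x ∧ y ≡ x → not y ≡ true → not x ≡ true
  below-false {false}       _ _  = refl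
  below-false {true} {true} _ ()
  join-false : ∀ {x y} → not x ≡ true → not y ≡ true → not (x ∨ y) ≡ true
  join-false {false} {false} _ _ = refl

finToFun-injective : ∀ {m n} {k l : Fin (m ^ n)} → finToFun {m} {n} k ≗ finToFun l → k ≡ l
finToFun-injective {m} {n} {k} {l} eq = begin
  k                             ≡⟨ funToFin-finToFin {n} {m} k ⟨
  funToFin (finToFun {m} {n} k) ≡⟨ funToFin-cong eq ⟩
  funToFin (finToFun {m} {n} l) ≡⟨ funToFin-finToFin {n} {m} l ⟩
  l                             ∎
  where
  funToFin-cong : ∀ {m n} {f g : Fin m → Fin n} → f ≗ g → funToFin f ≡ funToFin g
  funToFin-cong {zero}  _   = refl
  funToFin-cong {suc m} f≗g = cong₂ combine (f≗g zero) (funToFin-cong (f≗g ∘ suc))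

open Inverse 2↔Bool using () renaming (to to toBool; from to fromBool)

toBits : ∀ n → Fin (2 ^ n) → Fin n → Bool
toBits n k = toBool ∘ finToFun k

toBits-injective : ∀ n {k l : Fin (2 ^ n)} → toBits n k ≗ toBits n l → k ≡ l
toBits-injective n {k} {l} eq = finToFun-injective λ i → begin
  finToFun k i                    ≡⟨ strictlyInverseʳ (finToFun k i) ⟨
  fromBool (toBool (finToFun k i)) ≡⟨ cong fromBool (eq i) ⟩
  fromBool (toBool (finToFun l i)) ≡⟨ strictlyInverseʳ (finToFun l i) ⟩
  finToFun l i                    ∎
  where open Inverse 2↔Bool using (strictlyInverseʳ)

toBits-surjective : ∀ n (f : Fin n → Bool) → toBits n (funToFin (fromBool ∘ f)) ≗ f
toBits-surjective n f i =
  trans (cong toBool (finToFun-funToFin (fromBool ∘ f) i)) (strictlyInverseˡ (f i))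
  where open Inverse 2↔Bool using (strictlyInverseˡ)

toBits-combine : ∀ m (q : Fin 2) (r : Fin (2 ^ m)) →
                 toBits (suc m) (combine q r) ≗ toBool q Vector.∷ toBits m r
toBits-combine m q r zero    = cong (toBool ∘ proj₁) (remQuot-combine q r)
toBits-combine m q r (suc i) = cong (λ qr → toBits m (proj₂ qr) i) (remQuot-combine q r)

^-monoʳ-∣ : ∀ a {m n} → m ≤ n → a ^ m ∣ a ^ n
^-monoʳ-∣ a {m} {n} m≤n = divides (a ^ (n ∸ m)) (begin
  a ^ n                ≡⟨ cong (a ^_) (m∸n+n≡m m≤n) ⟨
  a ^ (n ∸ m + m)      ≡⟨ ^-distribˡ-+-* a (n ∸ m) m ⟩
  a ^ (n ∸ m) * a ^ m  ∎)

MB-entry-combine-zero : ∀ m (q : Fin 2) (r : Fin (2 ^ m)) →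
                        MB-entry (suc m) zero (combine q r) ≡ not (toBool q)
MB-entry-combine-zero m q r = begin
  MB-entry (suc m) zero (combine q r)
    ≡⟨ cong (_<ᵇ 2 ^ m) (m<n⇒m%n≡m {{m^n≢0 2 (suc m)}} (toℕ<n (combine q r))) ⟩
  toℕ (combine q r) <ᵇ 2 ^ m
    ≡⟨ leading-digit q ⟩
  not (toBool q) ∎
  where
  leading-digit : ∀ q → (toℕ (combine q r) <ᵇ 2 ^ m) ≡ not (toBool q)
  leading-digit zero rewrite toℕ-↑ˡ r (1 * 2 ^ m) = dec-true (toℕ r <? 2 ^ m) (toℕ<n r)
  leading-digit (suc zero) rewrite toℕ-↑ʳ (2 ^ m) (r ↑ˡ 0) =
    dec-false (2 ^ m + _ <? 2 ^ m) (≤⇒≯ (m≤m+n (2 ^ m) _))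

MB-entry-combine-suc : ∀ m (j : Fin m) (q : Fin 2) (r : Fin (2 ^ m)) →
                       MB-entry (suc m) (suc j) (combine q r) ≡ MB-entry m j r
MB-entry-combine-suc m j q r = cong (_<ᵇ 2 ^ (m ∸ suc (toℕ j))) (begin
  toℕ (combine q r) % d                 ≡⟨ cong (_% d) (toℕ-combine q r) ⟩
  (2 ^ m * toℕ q + toℕ r) % d           ≡⟨ %-remove-+ˡ (toℕ r) d∣2^m*q ⟩
  toℕ r % d                             ∎)
  where
  d = 2 ^ (m ∸ toℕ j)
  instance _ = m^n≢0 2 (m ∸ toℕ j)
  d∣2^m*q : d ∣ 2 ^ m * toℕ q
  d∣2^m*q = ∣-trans (^-monoʳ-∣ 2 (m∸n≤m m (toℕ j))) (m∣m*n (toℕ q))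

MB-entry≡not-toBits : ∀ n i k → MB-entry n i k ≡ not (toBits n k i)
MB-entry≡not-toBits (suc m) i k =
  subst (λ k → MB-entry (suc m) i k ≡ not (toBits (suc m) k i))
        (combine-remQuot {2} (2 ^ m) k)
        (on-combine i (proj₁ (remQuot {2} (2 ^ m) k)) (proj₂ (remQuot {2} (2 ^ m) k)))
  where
  on-combine : ∀ i q r → MB-entry (suc m) i (combine q r) ≡ not (toBits (suc m) (combine q r) i)
  on-combine zero q r = begin
    MB-entry (suc m) zero (combine q r)  ≡⟨ MB-entry-combine-zero m q r ⟩
    not (toBool q)                       ≡⟨ cong not (toBits-combine m q r zero) ⟨
    not (toBits (suc m) (combine q r) zero) ∎
  on-combine (suc j) q r = begin
    MB-entry (suc m) (suc j) (combine q r)  ≡⟨ MB-entry-combine-suc m j q r ⟩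
    MB-entry m j r                          ≡⟨ MB-entry≡not-toBits m j r ⟩
    not (toBits m r j)                      ≡⟨ cong not (toBits-combine m q r (suc j)) ⟨
    not (toBits (suc m) (combine q r) (suc j)) ∎

∣tabulate∣-↑ : ∀ a b (f : Fin (a + b) → Bool) →
               ∣ tabulate f ∣ ≡ ∣ tabulate (f ∘ (_↑ˡ b)) ∣ + ∣ tabulate (f ∘ (a ↑ʳ_)) ∣
∣tabulate∣-↑ zero    b f = refl
∣tabulate∣-↑ (suc a) b f with f zero
... | true  = cong suc (∣tabulate∣-↑ a b (f ∘ suc))
... | false = ∣tabulate∣-↑ a b (f ∘ suc)

∣tabulate∣-combine : ∀ c (f : Fin (2 * c) → Bool) →
                     ∣ tabulate f ∣ ≡ ∣ tabulate (f ∘ combine {2} {c} zero) ∣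
                                    + ∣ tabulate (f ∘ combine {2} {c} (suc zero)) ∣
∣tabulate∣-combine c f =
  trans (∣tabulate∣-↑ c (c + 0) f)
        (cong (∣ tabulate (f ∘ combine {2} {c} zero) ∣ +_)
              (trans (∣tabulate∣-↑ c 0 (f ∘ (c ↑ʳ_))) (+-identityʳ _)))

tabulate-const : ∀ {a} {A : Set a} n (x : A) → tabulate {n = n} (λ _ → x) ≡ replicate n x
tabulate-const n x = trans (tabulate-∘ (λ _ → x) id) (map-const (allFin n) x)

∣tabulate-not-toBits∣ : ∀ n (i : Fin n) → ∣ tabulate (λ k → not (toBits n k i)) ∣ ≡ 2 ^ (n ∸ 1)
∣tabulate-not-toBits∣ (suc m) i = begin
  ∣ tabulate (λ k → not (toBits (suc m) k i)) ∣
    ≡⟨ ∣tabulate∣-combine (2 ^ m) _ ⟩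
  ∣ tabulate (λ r → not (toBits (suc m) (combine {2} {2 ^ m} zero r) i)) ∣
    + ∣ tabulate (λ r → not (toBits (suc m) (combine {2} {2 ^ m} (suc zero) r) i)) ∣
    ≡⟨ cong₂ _+_ (half zero) (half (suc zero)) ⟩
  ∣ tabulate (λ r → not ((false Vector.∷ toBits m r) i)) ∣
    + ∣ tabulate (λ r → not ((true Vector.∷ toBits m r) i)) ∣
    ≡⟨ halves i ⟩
  2 ^ m ∎
  where
  half : ∀ q → ∣ tabulate (λ r → not (toBits (suc m) (combine {2} {2 ^ m} q r) i)) ∣
             ≡ ∣ tabulate (λ r → not ((toBool q Vector.∷ toBits m r) i)) ∣
  half q = cong ∣_∣ (tabulate-cong (λ r → cong not (toBits-combine m q r i)))
  halves : ∀ {m} (i : Fin (suc m)) →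
           ∣ tabulate (λ r → not ((false Vector.∷ toBits m r) i)) ∣
             + ∣ tabulate (λ r → not ((true Vector.∷ toBits m r) i)) ∣ ≡ 2 ^ m
  halves {m} zero = begin
    ∣ tabulate {n = 2 ^ m} (λ _ → true) ∣ + ∣ tabulate {n = 2 ^ m} (λ _ → false) ∣
      ≡⟨ cong₂ _+_ (cong ∣_∣ (tabulate-const (2 ^ m) true)) (cong ∣_∣ (tabulate-const (2 ^ m) false)) ⟩
    ∣ ⊤ {2 ^ m} ∣ + ∣ ⊥ {2 ^ m} ∣
      ≡⟨ cong₂ _+_ (∣⊤∣≡n (2 ^ m)) (∣⊥∣≡0 (2 ^ m)) ⟩
    2 ^ m + 0
      ≡⟨ +-identityʳ (2 ^ m) ⟩
    2 ^ m ∎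
  halves {suc m} (suc j) = begin
    ∣ tabulate (λ r → not (toBits (suc m) r j)) ∣ + ∣ tabulate (λ r → not (toBits (suc m) r j)) ∣
      ≡⟨ cong₂ _+_ (∣tabulate-not-toBits∣ (suc m) j) (∣tabulate-not-toBits∣ (suc m) j) ⟩
    2 ^ m + 2 ^ m
      ≡⟨ cong (2 ^ m +_) (+-identityʳ (2 ^ m)) ⟨
    2 ^ suc m ∎

theorem3 : (n : ℕ) → 2 ≤ n →
    Σ (BooleanAlgebra 0ℓ 0ℓ) λ B →
    Σ (Fin (2 ^ n) → BooleanAlgebra.Carrier B) λ b →
    IsEnumeration B (2 ^ n) b ×
    Σ (Fin n → BooleanAlgebra.Carrier B → Bool) λ J →
      (∀ i → IsIdeal B (J i)
           × card B b (J i) ≡ 2 ^ (n ∸ 1)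
           × codeword B b (J i) ≡ MB-row n i)
theorem3 n _ =
    pointwise ∨-∧-booleanAlgebra (Fin n)
  , toBits n
  , ((λ k l → toBits-injective n) , λ f → funToFin (fromBool ∘ f) , toBits-surjective n f)
  , (λ i f → not (f i))
  , λ i → coordinate-ideal (Fin n) i
        , ∣tabulate-not-toBits∣ n i
        , tabulate-cong (λ k → sym (MB-entry≡not-toBits n i k))
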